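{- Let $J\subseteq\mathrm{Hom}_{\mathbf{F}_p}(k,\overline{\mathbf{F}}_p)$ and $c\in\mathbf{Z}^{\mathrm{Hom}_{\mathbf{F}_p}(k,\overline{\mathbf{F}}_p)}$ with $c_\tau\in[1,p-1]$ for all $\tau$. Then $r=r(J,c)$ (defined using any admissible choice of $\tau_0$, if a choice is needed) satisfies \[ \sum_{i=0}^{f-1}(-1)^{\tau\circ\varphi^i\notin J}\,r_{\tau\circ\varphi^i}\,p^i\equiv\Omega_{\tau,c}\pmod{p^f-1} \] for every $\tau$, and $r_\tau\in[1,p]$ for all $\tau$.
   Context: $p$ is a prime, $k$ a finite field of degree $f$ over $\mathbf{F}_p$, $\varphi(x)=x^p$ on $k$, and embeddings $\tau\in\mathrm{Hom}_{\mathbf{F}_p}(k,\overline{\mathbf{F}}_p)$ are cycled by $\tau\mapsto\tau\circ\varphi$. For $a\in\mathbf{Z}^{\mathrm{Hom}_{\mathbf{F}_p}(k,\overline{\mathbf{F}}_p)}$, $\Omega_{\tau,a}=\sum_{i=0}^{f-1}p^ia_{\tau\circ\varphi^i}$. $(-1)^{\tau\notin J}$ is $-1$ if $\tau\notin J$ and $1$ if $\tau\in J$. Define $\delta_J(x,\tau)=y$ for $x\in\mathbf{Z}^{\mathrm{Hom}_{\mathbf{F}_p}(k,\overline{\mathbf{F}}_p)}$ and $\tau$: if $1\le x_\tau\le p$ then $y=x$. If $x_\tau\le0$, then $y_\tau=x_\tau+p$, $y_{\tau\circ\varphi}=x_{\tau\circ\varphi}-1$ if $\tau\circ\varphi\notin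 J$ and $x_{\tau\circ\varphi}+1$ if $\tau\circ\varphi\in J$, and $y_\sigma=x_\sigma$ for other $\sigma$. If $x_\tau>p$, then $y_\tau=x_\tau-p$, $y_{\tau\circ\varphi}=x_{\tau\circ\varphi}-1$ if $\tau\circ\varphi\notin J$ and $x_{\tau\circ\varphi}+1$ if $\tau\circ\varphi\in J$, and $y_\sigma=x_\sigma$ for other $\sigma$. Define $r(J,c)$: let $y_{0,\tau}=c_\tau$ if $\tau\in J,\tau\circ\varphi^{ -1}\in J$; $c_\tau+1$ if $\tau\in J,\tau\circ\varphi^{ -1}\notin J$; $p-c_\tau$ if $\tau\notin J,\tau\circ\varphi^{ -1}\in J$; $p-1-c_\tau$ if $\tau\notin J,\tau\circ\varphi^{ -1}\notin J$. If $y_{0,\tau}>0$ for all $\tau$, set $r(J,c)=y_0$. Otherwise choose $\tau_0$ with $y_{0,\tau_0}=0$, define $y_\kappa=\delta_J(y_{\kappa-1},\tau_0\circ\varphi^{\kappa-1})$ for $\kappa=1,\dots,f$, and set $r(J,c)=y_f$. -}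

module Defs where

open import Data.Nat as ℕ using (ℕ; zero; suc; NonZero; _∸_)
open import Data.Nat.DivMod using (_mod_)
open import Data.Fin using (Fin; toℕ; _≟_)
open import Data.Fin.Subset using (Subset; _∈_)
open import Data.Fin.Subset.Properties using (_∈?_)
open import Data.Integer as ℤ using (ℤ; +_; 0ℤ; 1ℤ; -1ℤ; _+_; _-_; _*_; -_; _^_; _≤_; _<_; _≤?_)
open import Relation.Nullary using (yes; no)
open import Relation.Binary.PropositionalEquality using (_≡_)

-- The embeddings Hom(k, F̄_p) form a single orbit of size f under
-- τ ↦ τ ∘ φ; we label them by Fin f so that τ ∘ φ^i corresponds to τ + i (mod f).
module _ (f : ℕ) .{{_ : NonZero f}} where

  φ^ : ℕ → Fin f → Fin f
  φ^ i τ = (toℕ τ ℕ.+ i) mod f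

  φ : Fin f → Fin f
  φ = φ^ 1

  φ⁻¹ : Fin f → Fin f
  φ⁻¹ = φ^ (f ∸ 1)

  Tuple : Set
  Tuple = Fin f → ℤ

  sumTo : ℕ → (ℕ → ℤ) → ℤ
  sumTo zero    g = 0ℤ
  sumTo (suc n) g = sumTo n g + g n

  Ω : ℕ → Tuple → Fin f → ℤ
  Ω p a τ = sumTo f (λ i → ((+ p) ^ i) * a (φ^ i τ))

  sgn : Subset f → Fin f → ℤ
  sgn J τ with τ ∈? J
  ... | yes _ = 1ℤ
  ... | no  _ = -1ℤ

  addAt : Tuple → Fin f → ℤ → Tuple
  addAt x σ d ρ with ρ ≟ σ
  ... | yes _ = x ρ + d
  ... | no  _ = x ρ

  δ : ℕ → Subset f → Tuple → Fin f → Tuple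
  δ p J x τ with x τ ≤? 0ℤ
  ... | yes _ = addAt (addAt x τ (+ p)) (φ τ) (sgn J (φ τ))
  ... | no  _ with x τ ≤? + p
  ...   | yes _ = x
  ...   | no  _ = addAt (addAt x τ (- (+ p))) (φ τ) (sgn J (φ τ))

  y₀ : ℕ → Subset f → Tuple → Tuple
  y₀ p J c τ with τ ∈? J | φ⁻¹ τ ∈? J
  ... | yes _ | yes _ = c τ
  ... | yes _ | no  _ = c τ + 1ℤ
  ... | no  _ | yes _ = + p - c τ
  ... | no  _ | no  _ = + p - 1ℤ - c τ

  iterδ : ℕ → Subset f → ℕ → Fin f → Tuple → Tuple
  iterδ p J zero    σ x = x
  iterδ p J (suc κ) σ x = iterδ p J κ (φ σ) (δ p J x σ)

  -- IsR p J c r : r is r(J,c) for some admissible choice of τ₀ (if needed)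
  data IsR (p : ℕ) (J : Subset f) (c : Tuple) : Tuple → Set where
    allPos  : (∀ τ → 0ℤ < y₀ p J c τ) → IsR p J c (y₀ p J c)
    viaZero : (τ₀ : Fin f) → y₀ p J c τ₀ ≡ 0ℤ →
              IsR p J c (iterδ p J f τ₀ (y₀ p J c))

{-# OPTIONS --safe #-}
module Submission where

-- Write s_ρ = (-1)^{ρ∉J} and L(x)_τ = Σ_{i<f} s_{τφ^i} x_{τφ^i} p^i.  For y₀ one checks
-- s_ρ y₀_ρ - c_ρ = u_{ρφ⁻¹} - p u_ρ with u_ρ = [ρ ∉ J], so L(y₀)_τ - Ω_{τ,c} telescopes around
-- the orbit to a multiple of p^f - 1.  A non-trivial δ-step at σ = τφ^i adds -s_σ p at σ and
-- s_{σφ} at σφ, changing L by -p^{i+1} + p^{i+1}, or by 1 - p^f when σφ wraps around to τ;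
-- hence L is constant modulo p^f - 1 along the construction of r.
-- For the bounds, y₀ lies in [1,p] on J and in [0,p-1] off J, so the coordinate about to be
-- normalised, having received at most one carry s_ρ, lies in [1,p+1] on J and [-1,p-1] off J;
-- one δ-step moves it into [1,p].  The only coordinate receiving a carry after it has been
-- normalised is τ₀ (where y₀ vanishes, so τ₀ ∉ J): it becomes p at the first step and p - 1
-- after the final carry.

open import Defs
open import Data.Nat as ℕ using (ℕ; NonZero; zero; suc; _%_; _∸_)
open import Data.Nat.Primality using (Prime; prime⇒nonTrivial)
open import Data.Nat.DivMod using (%-distribˡ-+; m%n%n≡m%n; [m+n]%n≡m%n; m<n⇒m%n≡m; m%n<n)
open import Data.Nat.Properties as ℕₚ using ()
open import Data.Fin as Fin using (Fin; toℕ)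
open import Data.Fin.Properties using (toℕ-injective; toℕ-fromℕ<; toℕ<n)
open import Data.Fin.Subset using (Subset)
open import Data.Fin.Subset.Properties using (_∈?_)
open import Data.Integer as ℤ using (ℤ; +_; 0ℤ; 1ℤ; -1ℤ; _+_; _-_; _*_; -_; _^_; _≤_; _≤?_)
open import Data.Integer.Properties as ℤₚ using ()
open import Data.Integer.Divisibility using (_∣_)
open import Data.Integer.Divisibility.Signed as Signed using (divides; ∣m∣n⇒∣m+n; ∣⇒∣ᵤ)
open import Data.Integer.Tactic.RingSolver using (solve-∀)
open import Data.Product using (_×_; _,_; proj₁; proj₂)
open import Data.Sum using (_⊎_; inj₁; inj₂)
open import Data.Empty using (⊥-elim)
open import Relation.Nullary using (Dec; yes; no; ¬_)
open import Relation.Binary.PropositionalEquality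
open import Function using (_∘_)

[m%d+n]%d≡[m+n]%d : ∀ m n d .{{_ : NonZero d}} → (m % d ℕ.+ n) % d ≡ (m ℕ.+ n) % d
[m%d+n]%d≡[m+n]%d m n d = begin
  (m % d ℕ.+ n) % d         ≡⟨ %-distribˡ-+ (m % d) n d ⟩
  (m % d % d ℕ.+ n % d) % d ≡⟨ cong (λ k → (k ℕ.+ n % d) % d) (m%n%n≡m%n m d) ⟩
  (m % d ℕ.+ n % d) % d     ≡⟨ %-distribˡ-+ m n d ⟨
  (m ℕ.+ n) % d             ∎
  where open ≡-Reasoning

module Orbit (f : ℕ) .{{_ : NonZero f}} where

  toℕ-φ^ : ∀ i τ → toℕ (φ^ f i τ) ≡ (toℕ τ ℕ.+ i) % f
  toℕ-φ^ i τ = toℕ-fromℕ< _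

  φ^-zero : ∀ τ → φ^ f 0 τ ≡ τ
  φ^-zero τ = toℕ-injective (begin
    toℕ (φ^ f 0 τ)     ≡⟨ toℕ-φ^ 0 τ ⟩
    (toℕ τ ℕ.+ 0) % f  ≡⟨ cong (_% f) (ℕₚ.+-identityʳ (toℕ τ)) ⟩
    toℕ τ % f          ≡⟨ m<n⇒m%n≡m (toℕ<n τ) ⟩
    toℕ τ              ∎)
    where open ≡-Reasoning

  φ^-+ : ∀ i j τ → φ^ f j (φ^ f i τ) ≡ φ^ f (i ℕ.+ j) τ
  φ^-+ i j τ = toℕ-injective (begin
    toℕ (φ^ f j (φ^ f i τ))        ≡⟨ toℕ-φ^ j (φ^ f i τ) ⟩
    (toℕ (φ^ f i τ) ℕ.+ j) % f     ≡⟨ cong (λ k → (k ℕ.+ j) % f) (toℕ-φ^ i τ) ⟩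
    ((toℕ τ ℕ.+ i) % f ℕ.+ j) % f  ≡⟨ [m%d+n]%d≡[m+n]%d (toℕ τ ℕ.+ i) j f ⟩
    (toℕ τ ℕ.+ i ℕ.+ j) % f        ≡⟨ cong (_% f) (ℕₚ.+-assoc (toℕ τ) i j) ⟩
    (toℕ τ ℕ.+ (i ℕ.+ j)) % f      ≡⟨ toℕ-φ^ (i ℕ.+ j) τ ⟨
    toℕ (φ^ f (i ℕ.+ j) τ)         ∎)
    where open ≡-Reasoning

  φ^-periodic : ∀ i τ → φ^ f (i ℕ.+ f) τ ≡ φ^ f i τ
  φ^-periodic i τ = toℕ-injective (begin
    toℕ (φ^ f (i ℕ.+ f) τ)       ≡⟨ toℕ-φ^ (i ℕ.+ f) τ ⟩
    (toℕ τ ℕ.+ (i ℕ.+ f)) % f    ≡⟨ cong (_% f) (ℕₚ.+-assoc (toℕ τ) i f) ⟨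
    (toℕ τ ℕ.+ i ℕ.+ f) % f      ≡⟨ [m+n]%n≡m%n (toℕ τ ℕ.+ i) f ⟩
    (toℕ τ ℕ.+ i) % f            ≡⟨ toℕ-φ^ i τ ⟨
    toℕ (φ^ f i τ)               ∎)
    where open ≡-Reasoning

  φ^-f : ∀ τ → φ^ f f τ ≡ τ
  φ^-f τ = trans (φ^-periodic 0 τ) (φ^-zero τ)

  φ-φ^ : ∀ i τ → φ f (φ^ f i τ) ≡ φ^ f (suc i) τ
  φ-φ^ i τ = trans (φ^-+ i 1 τ) (cong (λ k → φ^ f k τ) (ℕₚ.+-comm i 1))

  f≡suc[f∸1] : f ≡ suc (f ∸ 1)
  f≡suc[f∸1] = sym (ℕₚ.suc-pred f)

  φ⁻¹-φ^-suc : ∀ i τ → φ⁻¹ f (φ^ f (suc i) τ) ≡ φ^ f i τ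
  φ⁻¹-φ^-suc i τ = begin
    φ^ f (f ∸ 1) (φ^ f (suc i) τ) ≡⟨ φ^-+ (suc i) (f ∸ 1) τ ⟩
    φ^ f (suc i ℕ.+ (f ∸ 1)) τ    ≡⟨ cong (λ k → φ^ f k τ) (ℕₚ.+-suc i (f ∸ 1)) ⟨
    φ^ f (i ℕ.+ suc (f ∸ 1)) τ    ≡⟨ cong (λ k → φ^ f (i ℕ.+ k) τ) f≡suc[f∸1] ⟨
    φ^ f (i ℕ.+ f) τ              ≡⟨ φ^-periodic i τ ⟩
    φ^ f i τ                      ∎
    where open ≡-Reasoning

  φ⁻¹-φ^-zero : ∀ τ → φ⁻¹ f (φ^ f 0 τ) ≡ φ^ f (f ∸ 1) τ
  φ⁻¹-φ^-zero τ = φ^-+ 0 (f ∸ 1) τ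

  index : Fin f → Fin f → ℕ
  index τ ρ = (toℕ ρ ℕ.+ (f ∸ toℕ τ)) % f

  index<f : ∀ τ ρ → index τ ρ ℕ.< f
  index<f τ ρ = m%n<n _ f

  private
    shift-cancel : ∀ τ n → (toℕ τ ℕ.+ n ℕ.+ (f ∸ toℕ τ)) % f ≡ n % f
    shift-cancel τ n = begin
      (toℕ τ ℕ.+ n ℕ.+ (f ∸ toℕ τ)) % f ≡⟨ cong (λ k → (k ℕ.+ (f ∸ toℕ τ)) % f) (ℕₚ.+-comm (toℕ τ) n) ⟩
      (n ℕ.+ toℕ τ ℕ.+ (f ∸ toℕ τ)) % f ≡⟨ cong (_% f) (ℕₚ.+-assoc n (toℕ τ) _) ⟩
      (n ℕ.+ (toℕ τ ℕ.+ (f ∸ toℕ τ))) % f ≡⟨ cong (λ k → (n ℕ.+ k) % f) (ℕₚ.m+[n∸m]≡n (ℕₚ.<⇒≤ (toℕ<n τ))) ⟩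
      (n ℕ.+ f) % f ≡⟨ [m+n]%n≡m%n n f ⟩
      n % f ∎
      where open ≡-Reasoning

  φ^-index : ∀ τ ρ → φ^ f (index τ ρ) τ ≡ ρ
  φ^-index τ ρ = toℕ-injective (begin
    toℕ (φ^ f (index τ ρ) τ)                  ≡⟨ toℕ-φ^ (index τ ρ) τ ⟩
    (toℕ τ ℕ.+ index τ ρ) % f                 ≡⟨ cong (_% f) (ℕₚ.+-comm (toℕ τ) (index τ ρ)) ⟩
    (index τ ρ ℕ.+ toℕ τ) % f                 ≡⟨ [m%d+n]%d≡[m+n]%d _ (toℕ τ) f ⟩
    (toℕ ρ ℕ.+ (f ∸ toℕ τ) ℕ.+ toℕ τ) % f     ≡⟨ cong (_% f) (ℕₚ.+-comm _ (toℕ τ)) ⟩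
    (toℕ τ ℕ.+ (toℕ ρ ℕ.+ (f ∸ toℕ τ))) % f   ≡⟨ cong (_% f) (ℕₚ.+-assoc (toℕ τ) (toℕ ρ) _) ⟨
    (toℕ τ ℕ.+ toℕ ρ ℕ.+ (f ∸ toℕ τ)) % f     ≡⟨ shift-cancel τ (toℕ ρ) ⟩
    toℕ ρ % f                                 ≡⟨ m<n⇒m%n≡m (toℕ<n ρ) ⟩
    toℕ ρ                                     ∎)
    where open ≡-Reasoning

  index-φ^ : ∀ {i} τ → i ℕ.< f → index τ (φ^ f i τ) ≡ i
  index-φ^ {i} τ i<f = begin
    (toℕ (φ^ f i τ) ℕ.+ (f ∸ toℕ τ)) % f      ≡⟨ cong (λ k → (k ℕ.+ (f ∸ toℕ τ)) % f) (toℕ-φ^ i τ) ⟩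
    ((toℕ τ ℕ.+ i) % f ℕ.+ (f ∸ toℕ τ)) % f   ≡⟨ [m%d+n]%d≡[m+n]%d (toℕ τ ℕ.+ i) _ f ⟩
    (toℕ τ ℕ.+ i ℕ.+ (f ∸ toℕ τ)) % f         ≡⟨ shift-cancel τ i ⟩
    i % f                                     ≡⟨ m<n⇒m%n≡m i<f ⟩
    i                                         ∎
    where open ≡-Reasoning

  φ^-injective : ∀ {i j} τ → i ℕ.< f → j ℕ.< f → φ^ f i τ ≡ φ^ f j τ → i ≡ j
  φ^-injective {i} {j} τ i<f j<f eq = begin
    i                    ≡⟨ index-φ^ τ i<f ⟨
    index τ (φ^ f i τ)   ≡⟨ cong (index τ) eq ⟩
    index τ (φ^ f j τ)   ≡⟨ index-φ^ τ j<f ⟩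
    j                    ∎
    where open ≡-Reasoning

infix 4 _≡_[mod_]

_≡_[mod_] : ℤ → ℤ → ℤ → Set
a ≡ b [mod m ] = m Signed.∣ (a - b)

≡⇒≡-mod : ∀ {a b m} → a ≡ b → a ≡ b [mod m ]
≡⇒≡-mod {a} {m = m} refl = divides 0ℤ (trans (ℤₚ.+-inverseʳ a) (sym (ℤₚ.*-zeroˡ m)))

≡-mod-trans : ∀ {a b c m} → a ≡ b [mod m ] → b ≡ c [mod m ] → a ≡ c [mod m ]
≡-mod-trans {a} {b} {c} a≡b b≡c =
  subst (_ Signed.∣_) (telescope a b c) (∣m∣n⇒∣m+n a≡b b≡c)
  where
  telescope : ∀ a b c → (a - b) + (b - c) ≡ a - c
  telescope = solve-∀

module Sums (f : ℕ) .{{_ : NonZero f}} where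

  sumTo-cong : ∀ n {g h : ℕ → ℤ} → (∀ i → i ℕ.< n → g i ≡ h i) → sumTo f n g ≡ sumTo f n h
  sumTo-cong zero    g≡h = refl
  sumTo-cong (suc n) g≡h =
    cong₂ _+_ (sumTo-cong n (λ i i<n → g≡h i (ℕₚ.m<n⇒m<1+n i<n))) (g≡h n (ℕₚ.n<1+n n))

  sumTo-sub : ∀ n (g h : ℕ → ℤ) → sumTo f n g - sumTo f n h ≡ sumTo f n (λ i → g i - h i)
  sumTo-sub zero    g h = refl
  sumTo-sub (suc n) g h = trans (interchange (sumTo f n g) (sumTo f n h) (g n) (h n))
                                (cong (_+ (g n - h n)) (sumTo-sub n g h))
    where
    interchange : ∀ a b c d → (a + c) - (b + d) ≡ (a - b) + (c - d)
    interchange = solve-∀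

  sumTo-update : ∀ n k (g h : ℕ → ℤ) e → k ℕ.< n → (∀ i → i ℕ.< n → i ≢ k → h i ≡ g i) →
                 h k ≡ g k + e → sumTo f n h ≡ sumTo f n g + e
  sumTo-update (suc n) k g h e k<1+n h≡g hk with k ℕ.≟ n
  ... | yes refl = begin
    sumTo f k h + h k        ≡⟨ cong₂ _+_ (sumTo-cong k (λ i i<k → h≡g i (ℕₚ.m<n⇒m<1+n i<k) (ℕₚ.<⇒≢ i<k))) hk ⟩
    sumTo f k g + (g k + e)  ≡⟨ ℤₚ.+-assoc (sumTo f k g) (g k) e ⟨
    sumTo f k g + g k + e    ∎
    where open ≡-Reasoning
  ... | no k≢n = begin
    sumTo f n h + h n        ≡⟨ cong₂ _+_ (sumTo-update n k g h e k<n (λ i i<n → h≡g i (ℕₚ.m<n⇒m<1+n i<n)) hk)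
                                          (h≡g n (ℕₚ.n<1+n n) (k≢n ∘ sym)) ⟩
    sumTo f n g + e + g n    ≡⟨ swap (sumTo f n g) e (g n) ⟩
    sumTo f n g + g n + e    ∎
    where
    open ≡-Reasoning
    k<n = ℕₚ.≤∧≢⇒< (ℕ.s≤s⁻¹ k<1+n) k≢n
    swap : ∀ a b c → a + b + c ≡ a + c + b
    swap = solve-∀

  module _ (q : ℤ) (w : Fin f → ℤ) (τ : Fin f) where
    open Orbit f

    private
      term : ℕ → ℤ
      term i = q ^ i * (w (φ⁻¹ f (φ^ f i τ)) - q * w (φ^ f i τ))

      last = w (φ^ f (f ∸ 1) τ)

      partial-telescope : ∀ n → sumTo f (suc n) term ≡ last - q ^ suc n * w (φ^ f n τ)
      partial-telescope zero = begin
        0ℤ + 1ℤ * (w (φ⁻¹ f (φ^ f 0 τ)) - q * w (φ^ f 0 τ)) ≡⟨ cong (λ ρ → 0ℤ + 1ℤ * (w ρ - q * w (φ^ f 0 τ))) (φ⁻¹-φ^-zero τ) ⟩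
        0ℤ + 1ℤ * (last - q * w (φ^ f 0 τ))                 ≡⟨ normalise last (w (φ^ f 0 τ)) q ⟩
        last - q * 1ℤ * w (φ^ f 0 τ)                        ∎
        where
        open ≡-Reasoning
        normalise : ∀ a b q → 0ℤ + 1ℤ * (a - q * b) ≡ a - q * 1ℤ * b
        normalise = solve-∀
      partial-telescope (suc n) = begin
        sumTo f (suc n) term + term (suc n)
          ≡⟨ cong₂ _+_ (partial-telescope n) (cong (λ ρ → q ^ suc n * (w ρ - q * w (φ^ f (suc n) τ))) (φ⁻¹-φ^-suc n τ)) ⟩
        (last - q ^ suc n * w (φ^ f n τ)) + q ^ suc n * (w (φ^ f n τ) - q * w (φ^ f (suc n) τ))
          ≡⟨ cancel last (w (φ^ f n τ)) (w (φ^ f (suc n) τ)) (q ^ suc n) q ⟩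
        last - q * q ^ suc n * w (φ^ f (suc n) τ) ∎
        where
        open ≡-Reasoning
        cancel : ∀ a b b′ r q → (a - r * b) + r * (b - q * b′) ≡ a - q * r * b′
        cancel = solve-∀

    cyclic-telescope : (q ^ f - 1ℤ) Signed.∣ sumTo f f (λ i → q ^ i * (w (φ⁻¹ f (φ^ f i τ)) - q * w (φ^ f i τ)))
    cyclic-telescope = divides (- last) (begin
      sumTo f f term                       ≡⟨ cong (λ n → sumTo f n term) f≡suc[f∸1] ⟩
      sumTo f (suc (f ∸ 1)) term           ≡⟨ partial-telescope (f ∸ 1) ⟩
      last - q ^ suc (f ∸ 1) * last        ≡⟨ cong (λ n → last - q ^ n * last) f≡suc[f∸1] ⟨
      last - q ^ f * last                  ≡⟨ factor last (q ^ f) ⟩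
      - last * (q ^ f - 1ℤ)                ∎)
      where
      open ≡-Reasoning
      factor : ∀ a r → a - r * a ≡ - a * (r - 1ℤ)
      factor = solve-∀

module _ (f : ℕ) .{{_ : NonZero f}} where
  open Orbit f

  pow-index-φ : ∀ (q : ℤ) τ σ → q ^ index τ (φ f σ) ≡ q * q ^ index τ σ [mod q ^ f - 1ℤ ]
  pow-index-φ q τ σ with ℕₚ.m≤n⇒m<n∨m≡n (index<f τ σ)
  ... | inj₁ 1+i<f = ≡⇒≡-mod (cong (q ^_) (begin
    index τ (φ f σ)                ≡⟨ cong (index τ ∘ φ f) (φ^-index τ σ) ⟨
    index τ (φ f (φ^ f i τ))       ≡⟨ cong (index τ) (φ-φ^ i τ) ⟩
    index τ (φ^ f (suc i) τ)       ≡⟨ index-φ^ τ 1+i<f ⟩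
    suc i                          ∎))
    where
    open ≡-Reasoning
    i = index τ σ
  ... | inj₂ 1+i≡f = divides -1ℤ (begin
    q ^ index τ (φ f σ) - q ^ suc i   ≡⟨ cong₂ (λ m n → q ^ m - q ^ n) index-φσ≡0 1+i≡f ⟩
    1ℤ - q ^ f                        ≡⟨ negate (q ^ f) ⟩
    -1ℤ * (q ^ f - 1ℤ)                ∎)
    where
    open ≡-Reasoning
    i = index τ σ
    φσ≡τ : φ f σ ≡ φ^ f 0 τ
    φσ≡τ = begin
      φ f σ                    ≡⟨ cong (φ f) (φ^-index τ σ) ⟨
      φ f (φ^ f i τ)           ≡⟨ φ-φ^ i τ ⟩
      φ^ f (suc i) τ           ≡⟨ cong (λ n → φ^ f n τ) 1+i≡f ⟩
      φ^ f f τ                 ≡⟨ φ^-f τ ⟩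
      τ                        ≡⟨ φ^-zero τ ⟨
      φ^ f 0 τ                 ∎
    index-φσ≡0 : index τ (φ f σ) ≡ 0
    index-φσ≡0 = trans (cong (index τ) φσ≡τ) (index-φ^ τ (ℕ.>-nonZero⁻¹ f))
    negate : ∀ r → 1ℤ - r ≡ -1ℤ * (r - 1ℤ)
    negate = solve-∀

module AddAt (f : ℕ) .{{_ : NonZero f}} where

  addAt-same : ∀ x σ d → addAt f x σ d σ ≡ x σ + d
  addAt-same x σ d with σ Fin.≟ σ
  ... | yes _   = refl
  ... | no σ≢σ = ⊥-elim (σ≢σ refl)

  addAt-other : ∀ x σ d {ρ} → ρ ≢ σ → addAt f x σ d ρ ≡ x ρ
  addAt-other x σ d {ρ} ρ≢σ with ρ Fin.≟ σ
  ... | yes ρ≡σ = ⊥-elim (ρ≢σ ρ≡σ)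
  ... | no _    = refl

module Signs (f : ℕ) .{{_ : NonZero f}} (J : Subset f) where
  open AddAt f

  s : Fin f → ℤ
  s = sgn f J

  sgn-dichotomy : ∀ ρ → s ρ ≡ 1ℤ ⊎ s ρ ≡ -1ℤ
  sgn-dichotomy ρ with ρ ∈? J
  ... | yes _ = inj₁ refl
  ... | no _  = inj₂ refl

  sgn*sgn≡1 : ∀ ρ → s ρ * s ρ ≡ 1ℤ
  sgn*sgn≡1 ρ with sgn-dichotomy ρ
  ... | inj₁ s≡1  rewrite s≡1  = refl
  ... | inj₂ s≡-1 rewrite s≡-1 = refl

  carry : Tuple f → Fin f → ℤ → Tuple f
  carry x σ d = addAt f (addAt f x σ d) (φ f σ) (s (φ f σ))

  carry-other : ∀ x σ d {ρ} → ρ ≢ σ → ρ ≢ φ f σ → carry x σ d ρ ≡ x ρ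
  carry-other x σ d ρ≢σ ρ≢φσ = trans (addAt-other _ (φ f σ) _ ρ≢φσ) (addAt-other x σ d ρ≢σ)

  carry-source : ∀ x σ d → σ ≢ φ f σ → carry x σ d σ ≡ x σ + d
  carry-source x σ d σ≢φσ = trans (addAt-other _ (φ f σ) _ σ≢φσ) (addAt-same x σ d)

  carry-target : ∀ x σ d → φ f σ ≢ σ → carry x σ d (φ f σ) ≡ x (φ f σ) + s (φ f σ)
  carry-target x σ d φσ≢σ = trans (addAt-same _ (φ f σ) _) (cong (_+ s (φ f σ)) (addAt-other x σ d φσ≢σ))

  carry-fixed : ∀ x σ d → σ ≡ φ f σ → carry x σ d σ ≡ x σ + d + s σ
  carry-fixed x σ d σ≡φσ = begin
    addAt f (addAt f x σ d) (φ f σ) (s (φ f σ)) σ ≡⟨ cong (λ τ → addAt f (addAt f x σ d) τ (s τ) σ) σ≡φσ ⟨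
    addAt f (addAt f x σ d) σ (s σ) σ             ≡⟨ addAt-same _ σ (s σ) ⟩
    addAt f x σ d σ + s σ                         ≡⟨ cong (_+ s σ) (addAt-same x σ d) ⟩
    x σ + d + s σ                                 ∎
    where open ≡-Reasoning

module SignedSum (f : ℕ) .{{_ : NonZero f}} (p : ℕ) (J : Subset f) where
  open Orbit f
  open Sums f
  open AddAt f
  open Signs f J

  P M : ℤ
  P = + p
  M = P ^ f - 1ℤ

  signedΩ : Tuple f → Fin f → ℤ
  signedΩ r τ = sumTo f f (λ i → s (φ^ f i τ) * r (φ^ f i τ) * P ^ i)

  signedΩ-addAt : ∀ x σ d τ → signedΩ (addAt f x σ d) τ ≡ signedΩ x τ + s σ * d * P ^ index τ σ
  signedΩ-addAt x σ d τ = sumTo-update f k _ _ _ (index<f τ σ) unchanged changed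
    where
    k = index τ σ
    unchanged : ∀ i → i ℕ.< f → i ≢ k → s (φ^ f i τ) * addAt f x σ d (φ^ f i τ) * P ^ i ≡ s (φ^ f i τ) * x (φ^ f i τ) * P ^ i
    unchanged i i<f i≢k = cong (λ v → s (φ^ f i τ) * v * P ^ i)
      (addAt-other x σ d (λ eq → i≢k (φ^-injective τ i<f (index<f τ σ) (trans eq (sym (φ^-index τ σ))))))
    changed : s (φ^ f k τ) * addAt f x σ d (φ^ f k τ) * P ^ k ≡ s (φ^ f k τ) * x (φ^ f k τ) * P ^ k + s σ * d * P ^ k
    changed rewrite φ^-index τ σ | addAt-same x σ d = distrib (s σ) (x σ) d (P ^ k)
      where
      distrib : ∀ a b c q → a * (b + c) * q ≡ a * b * q + a * c * q
      distrib = solve-∀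

  signedΩ-carry : ∀ x σ d τ → s σ * d ≡ - P → signedΩ (carry x σ d) τ ≡ signedΩ x τ [mod M ]
  signedΩ-carry x σ d τ sd≡-P = subst (M Signed.∣_) (sym difference) (pow-index-φ f P τ σ)
    where
    open ≡-Reasoning
    i = index τ σ
    j = index τ (φ f σ)
    Sx = signedΩ x τ
    difference : signedΩ (carry x σ d) τ - Sx ≡ P ^ j - P * P ^ i
    difference = begin
      signedΩ (carry x σ d) τ - Sx
        ≡⟨ cong (_- Sx) (trans (signedΩ-addAt (addAt f x σ d) (φ f σ) _ τ) (cong (_+ _) (signedΩ-addAt x σ d τ))) ⟩
      Sx + s σ * d * P ^ i + s (φ f σ) * s (φ f σ) * P ^ j - Sx
        ≡⟨ cong₂ (λ a b → Sx + a * P ^ i + b * P ^ j - Sx) sd≡-P (sgn*sgn≡1 (φ f σ)) ⟩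
      Sx + - P * P ^ i + 1ℤ * P ^ j - Sx
        ≡⟨ collect Sx P (P ^ i) (P ^ j) ⟩
      P ^ j - P * P ^ i ∎
      where
      collect : ∀ a P u v → a + - P * u + 1ℤ * v - a ≡ v - P * u
      collect = solve-∀

module Normalisation (f : ℕ) .{{_ : NonZero f}} (p : ℕ) (p>1 : 1 ℕ.< p) (J : Subset f) where
  open Signs f J
  open SignedSum f p J

  InRange : ℤ → Set
  InRange v = 1ℤ ≤ v × v ≤ P

  Near : Fin f → ℤ → Set
  Near ρ v = s ρ ≤ v × v ≤ P + s ρ

  data Step (x : Tuple f) (σ : Fin f) : Tuple f → Set where
    stays   : InRange (x σ) → Step x σ x
    carries : ∀ d → s σ * d ≡ - P → InRange (x σ + d) → Step x σ (carry x σ d)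

  1≤-1+P : 1ℤ ≤ -1ℤ + P
  1≤-1+P = ℤₚ.+-monoʳ-≤ -1ℤ (ℤ.+≤+ p>1)

  1≰0 : ¬ 1ℤ ≤ 0ℤ
  1≰0 (ℤ.+≤+ ())

  δ-step : ∀ x σ → Near σ (x σ) → Step x σ (δ f p J x σ)
  δ-step x σ (lo , hi) with x σ ≤? 0ℤ | sgn-dichotomy σ
  ... | yes v≤0 | inj₁ s≡1 = ⊥-elim (1≰0 (ℤₚ.≤-trans (subst (_≤ x σ) s≡1 lo) v≤0))
  ... | yes v≤0 | inj₂ s≡-1 = carries P sP≡-P (lower , ℤₚ.+-monoˡ-≤ P v≤0)
    where
    sP≡-P : s σ * P ≡ - P
    sP≡-P = trans (cong (_* P) s≡-1) (ℤₚ.-1*i≡-i P)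
    lower : 1ℤ ≤ x σ + P
    lower = ℤₚ.≤-trans 1≤-1+P (ℤₚ.+-monoˡ-≤ P (subst (_≤ x σ) s≡-1 lo))
  ... | no v≰0 | s≡±1 with x σ ≤? + p | s≡±1
  ...   | yes v≤P | _ = stays (ℤₚ.i<j⇒suc[i]≤j (ℤₚ.≰⇒> v≰0) , v≤P)
  ...   | no v≰P | inj₂ s≡-1 =
    ⊥-elim (v≰P (ℤₚ.≤-trans (subst (λ t → x σ ≤ P + t) s≡-1 hi) (ℤₚ.i-j≤i P 1ℤ)))
  ...   | no v≰P | inj₁ s≡1 = carries (- P) s[-P]≡-P (subst InRange (sym v-P≡1) (ℤₚ.≤-refl , ℤ.+≤+ (ℕₚ.<⇒≤ p>1)))
    where
    s[-P]≡-P : s σ * - P ≡ - P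
    s[-P]≡-P = trans (cong (_* - P) s≡1) (ℤₚ.*-identityˡ (- P))
    v≡P+1 : x σ ≡ P + 1ℤ
    v≡P+1 = ℤₚ.≤-antisym (subst (λ t → x σ ≤ P + t) s≡1 hi)
                         (subst (_≤ x σ) (ℤₚ.+-comm 1ℤ P) (ℤₚ.i<j⇒suc[i]≤j (ℤₚ.≰⇒> v≰P)))
    v-P≡1 : x σ + - P ≡ 1ℤ
    v-P≡1 = trans (cong (_+ - P) v≡P+1) (cancel P)
      where
      cancel : ∀ a → a + 1ℤ + - a ≡ 1ℤ
      cancel = solve-∀

module InitialTuple (f : ℕ) .{{_ : NonZero f}} (p : ℕ) (p>1 : 1 ℕ.< p) (J : Subset f) (c : Tuple f)
                    (c-bounds : ∀ τ → 1ℤ ≤ c τ × c τ ≤ + p - 1ℤ) where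
  open Sums f
  open Signs f J
  open SignedSum f p J
  open Normalisation f p p>1 J

  y : Tuple f
  y = y₀ f p J c

  missing : Fin f → ℤ
  missing ρ with ρ ∈? J
  ... | yes _ = 0ℤ
  ... | no _  = 1ℤ

  y₀-identity : ∀ ρ → s ρ * y ρ - c ρ ≡ missing (φ⁻¹ f ρ) - P * missing ρ
  y₀-identity ρ with ρ ∈? J | φ⁻¹ f ρ ∈? J
  ... | yes _ | yes _ = identity (c ρ) P
    where
    identity : ∀ c P → 1ℤ * c - c ≡ 0ℤ - P * 0ℤ
    identity = solve-∀
  ... | yes _ | no _  = identity (c ρ) P
    where
    identity : ∀ c P → 1ℤ * (c + 1ℤ) - c ≡ 1ℤ - P * 0ℤ
    identity = solve-∀
  ... | no _  | yes _ = identity (c ρ) P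
    where
    identity : ∀ c P → -1ℤ * (P - c) - c ≡ 0ℤ - P * 1ℤ
    identity = solve-∀
  ... | no _  | no _  = identity (c ρ) P
    where
    identity : ∀ c P → -1ℤ * (P - 1ℤ - c) - c ≡ 1ℤ - P * 1ℤ
    identity = solve-∀

  signedΩ-y₀ : ∀ τ → signedΩ y τ ≡ Ω f p c τ [mod M ]
  signedΩ-y₀ τ = subst (M Signed.∣_) (sym termwise) (cyclic-telescope P missing τ)
    where
    open ≡-Reasoning
    termwise : signedΩ y τ - Ω f p c τ ≡ sumTo f f (λ i → P ^ i * (missing (φ⁻¹ f (φ^ f i τ)) - P * missing (φ^ f i τ)))
    termwise = trans (sumTo-sub f _ _) (sumTo-cong f (λ i _ → begin
      s (φ^ f i τ) * y (φ^ f i τ) * P ^ i - P ^ i * c (φ^ f i τ) ≡⟨ factor (s (φ^ f i τ)) (y (φ^ f i τ)) (c (φ^ f i τ)) (P ^ i) ⟩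
      P ^ i * (s (φ^ f i τ) * y (φ^ f i τ) - c (φ^ f i τ))      ≡⟨ cong (P ^ i *_) (y₀-identity (φ^ f i τ)) ⟩
      P ^ i * (missing (φ⁻¹ f (φ^ f i τ)) - P * missing (φ^ f i τ)) ∎))
      where
      factor : ∀ a v w q → a * v * q - q * w ≡ q * (a * v - w)
      factor = solve-∀

  private
    x-j≤x-i : ∀ x {i j} → i ≤ j → x - j ≤ x - i
    x-j≤x-i x i≤j = ℤₚ.+-monoʳ-≤ x (ℤₚ.neg-mono-≤ i≤j)

    0≡x-x : ∀ x → 0ℤ ≡ x - x
    0≡x-x x = sym (ℤₚ.+-inverseʳ x)

    P-1≤P : P - 1ℤ ≤ P
    P-1≤P = ℤₚ.i-j≤i P 1ℤ

  y₀-range : ∀ ρ → (s ρ ≡ 1ℤ → InRange (y ρ)) × (s ρ ≡ -1ℤ → 0ℤ ≤ y ρ × y ρ ≤ P - 1ℤ)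
  y₀-range ρ with ρ ∈? J | φ⁻¹ f ρ ∈? J | c-bounds ρ
  ... | yes _ | yes _ | 1≤c , c≤P-1 = (λ _ → 1≤c , ℤₚ.≤-trans c≤P-1 P-1≤P) , λ ()
  ... | yes _ | no _  | 1≤c , c≤P-1 =
    (λ _ → ℤₚ.≤-trans 1≤c (ℤₚ.i≤i+j (c ρ) 1ℤ) ,
           ℤₚ.≤-trans (ℤₚ.+-monoˡ-≤ 1ℤ c≤P-1) (ℤₚ.≤-reflexive (cancel P))) , λ ()
    where
    cancel : ∀ a → a - 1ℤ + 1ℤ ≡ a
    cancel = solve-∀
  ... | no _  | yes _ | 1≤c , c≤P-1 =
    (λ ()) , λ _ → subst (_≤ P - c ρ) (sym (0≡x-x P)) (x-j≤x-i P (ℤₚ.≤-trans c≤P-1 P-1≤P)) , x-j≤x-i P 1≤c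
  ... | no _  | no _  | 1≤c , c≤P-1 =
    (λ ()) , λ _ → subst (_≤ P - 1ℤ - c ρ) (sym (0≡x-x (P - 1ℤ))) (x-j≤x-i (P - 1ℤ) c≤P-1) ,
                   subst (P - 1ℤ - c ρ ≤_) (ℤₚ.+-identityʳ (P - 1ℤ)) (x-j≤x-i (P - 1ℤ) (ℤₚ.≤-trans (ℤ.+≤+ ℕ.z≤n) 1≤c))

  y₀≤P : ∀ ρ → y ρ ≤ P
  y₀≤P ρ with sgn-dichotomy ρ | y₀-range ρ
  ... | inj₁ s≡1  | in-J , _  = proj₂ (in-J s≡1)
  ... | inj₂ s≡-1 | _ , out-J = ℤₚ.≤-trans (proj₂ (out-J s≡-1)) P-1≤P

  y₀-near : ∀ ρ → Near ρ (y ρ)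
  y₀-near ρ with sgn-dichotomy ρ | y₀-range ρ
  ... | inj₁ s≡1  | in-J , _  rewrite s≡1 =
    proj₁ (in-J refl) , ℤₚ.≤-trans (proj₂ (in-J refl)) (ℤₚ.i≤i+j P 1ℤ)
  ... | inj₂ s≡-1 | _ , out-J rewrite s≡-1 =
    ℤₚ.≤-trans ℤ.-≤+ (proj₁ (out-J refl)) , proj₂ (out-J refl)

  y₀-near-shifted : ∀ ρ → Near ρ (y ρ + s ρ)
  y₀-near-shifted ρ with sgn-dichotomy ρ | y₀-range ρ
  ... | inj₁ s≡1  | in-J , _  rewrite s≡1 =
    ℤₚ.≤-trans (proj₁ (in-J refl)) (ℤₚ.i≤i+j (y ρ) 1ℤ) , ℤₚ.+-monoˡ-≤ 1ℤ (proj₂ (in-J refl))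
  ... | inj₂ s≡-1 | _ , out-J rewrite s≡-1 =
    ℤₚ.+-monoˡ-≤ -1ℤ (proj₁ (out-J refl)) ,
    ℤₚ.≤-trans (ℤₚ.+-monoˡ-≤ -1ℤ (proj₂ (out-J refl))) (ℤₚ.i-j≤i (P - 1ℤ) 1ℤ)

module Trajectory (f : ℕ) .{{_ : NonZero f}} (p : ℕ) (p>1 : 1 ℕ.< p) (J : Subset f) (c : Tuple f)
                  (c-bounds : ∀ τ → 1ℤ ≤ c τ × c τ ≤ + p - 1ℤ)
                  (τ₀ : Fin f) (y[τ₀]≡0 : y₀ f p J c τ₀ ≡ 0ℤ) where
  open Orbit f
  open Signs f J
  open SignedSum f p J
  open Normalisation f p p>1 J
  open InitialTuple f p p>1 J c c-bounds

  pos : ℕ → Fin f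
  pos j = φ^ f j τ₀

  pos-distinct : ∀ {i j} → i ℕ.< f → j ℕ.< f → i ≢ j → pos i ≢ pos j
  pos-distinct i<f j<f i≢j = i≢j ∘ φ^-injective τ₀ i<f j<f

  0<f : 0 ℕ.< f
  0<f = ℕ.>-nonZero⁻¹ f

  y[pos0]≡0 : y (pos 0) ≡ 0ℤ
  y[pos0]≡0 = trans (cong y (φ^-zero τ₀)) y[τ₀]≡0

  s[pos0]≡-1 : s (pos 0) ≡ -1ℤ
  s[pos0]≡-1 with sgn-dichotomy (pos 0)
  ... | inj₂ s≡-1 = s≡-1
  ... | inj₁ s≡1  = ⊥-elim (1≰0 (subst₂ _≤_ s≡1 y[pos0]≡0 (proj₁ (y₀-near (pos 0)))))

  start : ℕ → ℤ
  start zero    = 0ℤ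
  start (suc _) = P

  start≡P : ∀ {κ} → κ ≢ 0 → start κ ≡ P
  start≡P {zero}  κ≢0 = ⊥-elim (κ≢0 refl)
  start≡P {suc _} _   = refl

  record Invariant (κ : ℕ) (x : Tuple f) : Set where
    field
      in-range  : ∀ j → j ℕ.< κ → InRange (x (pos j))
      untouched : ∀ j → κ ℕ.< j → j ℕ.< f → x (pos j) ≡ y (pos j)
      near      : κ ℕ.< f → Near (pos κ) (x (pos κ))
      -- position 0 receives the carry of the last step
      at-start  : κ ℕ.< f → x (pos 0) ≡ start κ
      congruent : ∀ τ → signedΩ x τ ≡ signedΩ y τ [mod M ]
  open Invariant

  invariant-zero : Invariant 0 y
  invariant-zero = record
    { in-range  = λ _ ()
    ; untouched = λ _ _ _ → refl
    ; near      = λ _ → y₀-near (pos 0)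
    ; at-start  = λ _ → y[pos0]≡0
    ; congruent = λ τ → ≡⇒≡-mod {signedΩ y τ} refl
    }

  settled-step : ∀ {κ x} → κ ℕ.< f → Invariant κ x → InRange (x (pos κ)) → Invariant (suc κ) x
  settled-step {κ} {x} κ<f inv x[κ]-in-range = record
    { in-range  = in-range′
    ; untouched = λ j 1+κ<j → untouched inv j (ℕₚ.<-trans (ℕₚ.n<1+n κ) 1+κ<j)
    ; near      = λ 1+κ<f → subst (Near (pos (suc κ))) (sym (untouched inv (suc κ) (ℕₚ.n<1+n κ) 1+κ<f)) (y₀-near _)
    ; at-start  = at-start′
    ; congruent = congruent inv
    }
    where
    in-range′ : ∀ j → j ℕ.< suc κ → InRange (x (pos j))
    in-range′ j j<1+κ with ℕₚ.m≤n⇒m<n∨m≡n (ℕ.s≤s⁻¹ j<1+κ)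
    ... | inj₁ j<κ  = in-range inv j j<κ
    ... | inj₂ refl = x[κ]-in-range
    at-start′ : suc κ ℕ.< f → x (pos 0) ≡ P
    at-start′ _ with κ ℕ.≟ 0
    ... | yes refl = ⊥-elim (1≰0 (subst (1ℤ ≤_) (at-start inv κ<f) (proj₁ x[κ]-in-range)))
    ... | no κ≢0   = trans (at-start inv κ<f) (start≡P κ≢0)

  module _ {κ x d} (κ<f : κ ℕ.< f) (inv : Invariant κ x)
           (sd≡-P : s (pos κ) * d ≡ - P) (x[κ]+d-in-range : InRange (x (pos κ) + d)) where
    private
      σ = pos κ
      x′ = carry x σ d

      φσ≡pos[1+κ] : φ f σ ≡ pos (suc κ)
      φσ≡pos[1+κ] = φ-φ^ κ τ₀

      last-target : suc κ ≡ f → φ f σ ≡ pos 0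
      last-target 1+κ≡f = trans φσ≡pos[1+κ] (trans (cong pos 1+κ≡f) (trans (φ^-f τ₀) (sym (φ^-zero τ₀))))

      inner-target : suc κ ℕ.< f → σ ≢ φ f σ
      inner-target 1+κ<f σ≡φσ = pos-distinct κ<f 1+κ<f (ℕₚ.<⇒≢ (ℕₚ.n<1+n κ)) (trans σ≡φσ φσ≡pos[1+κ])

      other-than-source : ∀ {j} → j ℕ.< f → j ≢ κ → pos j ≢ σ
      other-than-source j<f j≢κ = pos-distinct j<f κ<f j≢κ

      x[σ]≡0-at-first : κ ≡ 0 → x σ ≡ 0ℤ
      x[σ]≡0-at-first refl = at-start inv κ<f

      d≡P-at-first : κ ≡ 0 → d ≡ P
      d≡P-at-first refl = begin
        d           ≡⟨ ℤₚ.neg-involutive d ⟨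
        - - d       ≡⟨ cong -_ (ℤₚ.-1*i≡-i d) ⟨
        - (-1ℤ * d) ≡⟨ cong (λ t → - (t * d)) s[pos0]≡-1 ⟨
        - (s σ * d) ≡⟨ cong -_ sd≡-P ⟩
        - - P       ≡⟨ ℤₚ.neg-involutive P ⟩
        P           ∎
        where open ≡-Reasoning

      wraps-to-start : ∀ {j} → j ℕ.< suc κ → pos j ≡ φ f σ → j ≡ 0 × suc κ ≡ f
      wraps-to-start {j} j<1+κ pos[j]≡φσ with ℕₚ.m≤n⇒m<n∨m≡n κ<f
      ... | inj₁ 1+κ<f = ⊥-elim (pos-distinct (ℕₚ.<-trans j<1+κ 1+κ<f) 1+κ<f (ℕₚ.<⇒≢ j<1+κ) (trans pos[j]≡φσ φσ≡pos[1+κ]))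
      ... | inj₂ 1+κ≡f = φ^-injective τ₀ (ℕₚ.<-≤-trans j<1+κ κ<f) 0<f (trans pos[j]≡φσ (last-target 1+κ≡f)) , 1+κ≡f

      last-carry-at-start : suc κ ≡ f → x′ (pos 0) ≡ P + -1ℤ
      last-carry-at-start 1+κ≡f with κ ℕ.≟ 0
      ... | yes κ≡0 = begin
        x′ (pos 0)      ≡⟨ cong x′ σ≡pos0 ⟨
        x′ σ            ≡⟨ carry-fixed x σ d (trans σ≡pos0 (sym (last-target 1+κ≡f))) ⟩
        x σ + d + s σ   ≡⟨ cong₂ _+_ (cong₂ _+_ (x[σ]≡0-at-first κ≡0) (d≡P-at-first κ≡0)) (trans (cong s σ≡pos0) s[pos0]≡-1) ⟩
        P + -1ℤ         ∎
        where
        open ≡-Reasoning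
        σ≡pos0 = cong pos κ≡0
      ... | no κ≢0 = begin
        x′ (pos 0)              ≡⟨ cong x′ (last-target 1+κ≡f) ⟨
        x′ (φ f σ)              ≡⟨ carry-target x σ d (λ φσ≡σ → pos0≢σ (trans (sym (last-target 1+κ≡f)) φσ≡σ)) ⟩
        x (φ f σ) + s (φ f σ)   ≡⟨ cong (λ ρ → x ρ + s ρ) (last-target 1+κ≡f) ⟩
        x (pos 0) + s (pos 0)   ≡⟨ cong₂ _+_ (trans (at-start inv κ<f) (start≡P κ≢0)) s[pos0]≡-1 ⟩
        P + -1ℤ                 ∎
        where
        open ≡-Reasoning
        pos0≢σ = other-than-source 0<f (κ≢0 ∘ sym)

      in-range′ : ∀ j → j ℕ.< suc κ → InRange (x′ (pos j))
      in-range′ j j<1+κ = by-target (pos j Fin.≟ φ f σ)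
        where
        by-target : Dec (pos j ≡ φ f σ) → InRange (x′ (pos j))
        by-target (yes pos[j]≡φσ) with wraps-to-start j<1+κ pos[j]≡φσ
        ... | refl , 1+κ≡f = subst InRange (sym (last-carry-at-start 1+κ≡f))
                               (ℤₚ.≤-trans 1≤-1+P (ℤₚ.≤-reflexive (ℤₚ.+-comm -1ℤ P)) , ℤₚ.i-j≤i P 1ℤ)
        by-target (no pos[j]≢φσ) with ℕₚ.m≤n⇒m<n∨m≡n (ℕ.s≤s⁻¹ j<1+κ)
        ... | inj₁ j<κ  = subst InRange (sym (carry-other x σ d (other-than-source (ℕₚ.<-trans j<κ κ<f) (ℕₚ.<⇒≢ j<κ)) pos[j]≢φσ))
                                (in-range inv j j<κ)
        ... | inj₂ refl = subst InRange (sym (carry-source x σ d pos[j]≢φσ)) x[κ]+d-in-range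

      untouched′ : ∀ j → suc κ ℕ.< j → j ℕ.< f → x′ (pos j) ≡ y (pos j)
      untouched′ j 1+κ<j j<f = trans (carry-other x σ d (other-than-source j<f (ℕₚ.>⇒≢ κ<j)) pos[j]≢φσ)
                                     (untouched inv j κ<j j<f)
        where
        κ<j = ℕₚ.<-trans (ℕₚ.n<1+n κ) 1+κ<j
        pos[j]≢φσ : pos j ≢ φ f σ
        pos[j]≢φσ eq = pos-distinct j<f (ℕₚ.<-trans 1+κ<j j<f) (ℕₚ.>⇒≢ 1+κ<j) (trans eq φσ≡pos[1+κ])

      near′ : suc κ ℕ.< f → Near (pos (suc κ)) (x′ (pos (suc κ)))
      near′ 1+κ<f = subst (λ ρ → Near ρ (x′ ρ)) φσ≡pos[1+κ]
        (subst (Near (φ f σ)) (sym x′[φσ]) (y₀-near-shifted (φ f σ)))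
        where
        x′[φσ] : x′ (φ f σ) ≡ y (φ f σ) + s (φ f σ)
        x′[φσ] = begin
          x′ (φ f σ)              ≡⟨ carry-target x σ d (inner-target 1+κ<f ∘ sym) ⟩
          x (φ f σ) + s (φ f σ)   ≡⟨ cong (_+ s (φ f σ)) (trans (cong x φσ≡pos[1+κ])
                                       (trans (untouched inv (suc κ) (ℕₚ.n<1+n κ) 1+κ<f) (cong y (sym φσ≡pos[1+κ])))) ⟩
          y (φ f σ) + s (φ f σ)   ∎
          where open ≡-Reasoning

      at-start′ : suc κ ℕ.< f → x′ (pos 0) ≡ P
      at-start′ 1+κ<f with κ ℕ.≟ 0
      ... | yes κ≡0 = begin
        x′ (pos 0)   ≡⟨ cong x′ (cong pos κ≡0) ⟨
        x′ σ         ≡⟨ carry-source x σ d (inner-target 1+κ<f) ⟩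
        x σ + d      ≡⟨ cong₂ _+_ (x[σ]≡0-at-first κ≡0) (d≡P-at-first κ≡0) ⟩
        P            ∎
        where open ≡-Reasoning
      ... | no κ≢0 = begin
        x′ (pos 0)   ≡⟨ carry-other x σ d (other-than-source 0<f (κ≢0 ∘ sym))
                          (λ eq → pos-distinct 0<f 1+κ<f (λ ()) (trans eq φσ≡pos[1+κ])) ⟩
        x (pos 0)    ≡⟨ at-start inv κ<f ⟩
        start κ      ≡⟨ start≡P κ≢0 ⟩
        P            ∎
        where open ≡-Reasoning

    carried-step : Invariant (suc κ) (carry x (pos κ) d)
    carried-step = record
      { in-range  = in-range′
      ; untouched = untouched′
      ; near      = near′
      ; at-start  = at-start′
      ; congruent = λ τ → ≡-mod-trans {signedΩ x′ τ} {signedΩ x τ} (signedΩ-carry x σ d τ sd≡-P) (congruent inv τ)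
      }

  invariant-step : ∀ {κ x} → κ ℕ.< f → Invariant κ x → Invariant (suc κ) (δ f p J x (pos κ))
  invariant-step {κ} {x} κ<f inv with δ f p J x (pos κ) | δ-step x (pos κ) (near inv κ<f)
  ... | _ | stays in-range-κ            = settled-step κ<f inv in-range-κ
  ... | _ | carries d sd≡-P in-range-κ = carried-step κ<f inv sd≡-P in-range-κ

  invariant-iterate : ∀ m {κ x} → κ ℕ.+ m ≡ f → Invariant κ x → Invariant f (iterδ f p J m (pos κ) x)
  invariant-iterate zero    {κ} κ+0≡f inv = subst (λ k → Invariant k _) (trans (sym (ℕₚ.+-identityʳ κ)) κ+0≡f) inv
  invariant-iterate (suc m) {κ} {x} κ+1+m≡f inv =
    subst (λ ρ → Invariant f (iterδ f p J m ρ (δ f p J x (pos κ)))) (sym (φ-φ^ κ τ₀))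
      (invariant-iterate m (trans (sym (ℕₚ.+-suc κ m)) κ+1+m≡f) (invariant-step κ<f inv))
    where
    κ<f : κ ℕ.< f
    κ<f = subst (κ ℕ.<_) κ+1+m≡f (ℕₚ.m<m+n κ (ℕ.s≤s ℕ.z≤n))

  final-invariant : Invariant f (iterδ f p J f τ₀ y)
  final-invariant = subst (λ ρ → Invariant f (iterδ f p J f ρ y)) (φ^-zero τ₀) (invariant-iterate f refl invariant-zero)

  final-congruent : ∀ τ → signedΩ (iterδ f p J f τ₀ y) τ ≡ Ω f p c τ [mod M ]
  final-congruent τ = ≡-mod-trans {signedΩ (iterδ f p J f τ₀ y) τ} (congruent final-invariant τ) (signedΩ-y₀ τ)

  final-in-range : ∀ ρ → InRange (iterδ f p J f τ₀ y ρ)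
  final-in-range ρ = subst (λ ρ′ → InRange (iterδ f p J f τ₀ y ρ′)) (φ^-index τ₀ ρ)
                       (in-range final-invariant (index τ₀ ρ) (index<f τ₀ ρ))

mainTheorem5 : (p f : ℕ) .{{_ : NonZero f}} → Prime p →
    (J : Subset f) (c : Tuple f) →
    (∀ τ → 1ℤ ≤ c τ × c τ ≤ + p - 1ℤ) →
    (r : Tuple f) → IsR f p J c r →
    (∀ τ → ((+ p) ^ f - 1ℤ) ∣ (sumTo f f (λ i → sgn f J (φ^ f i τ) * r (φ^ f i τ) * (+ p) ^ i) - Ω f p c τ))
    × (∀ τ → 1ℤ ≤ r τ × r τ ≤ + p)
mainTheorem5 p f p-prime J c c-bounds = properties
  where
  p>1 = ℕ.nonTrivial⇒n>1 p {{prime⇒nonTrivial p-prime}}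
  open SignedSum f p J
  open Normalisation f p p>1 J
  open InitialTuple f p p>1 J c c-bounds

  properties : ∀ r → IsR f p J c r → (∀ τ → M ∣ (signedΩ r τ - Ω f p c τ)) × (∀ τ → InRange (r τ))
  properties _ (IsR.allPos y>0) = ∣⇒∣ᵤ ∘ signedΩ-y₀ , λ ρ → ℤₚ.i<j⇒suc[i]≤j (y>0 ρ) , y₀≤P ρ
  properties _ (IsR.viaZero τ₀ y[τ₀]≡0) = ∣⇒∣ᵤ ∘ final-congruent , final-in-range
    where open Trajectory f p p>1 J c c-bounds τ₀ y[τ₀]≡0
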